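{- Let $\Lambda,\Gamma$ be $S$-sorted sets of formulas, $s\in S$ and $\phi\in Form_s$. Then $\Gamma\vdash_{\mathbf K\Lambda}\phi$ if and only if $(\Gamma_G)_s\vdash^s_{\mathbf K\Lambda}\phi$.
   Context: Let $(S,\Sigma)$ be a many-sorted signature (each $\sigma\in\Sigma$ has a type $s_1\ldots s_n\to s$, $n\ge0$; $\Sigma_{s_1\ldots s_n,s}$ the symbols of that type; $[n]=\{1,\ldots,n\}$), and $P=\{P_s\}_{s\in S}$ nonempty pairwise disjoint sets of propositional variables. Formulas $Form_s$: $P_s\subseteq Form_s$, closure under $\neg,\vee$ within a sort, and $\sigma(\phi_1,\ldots,\phi_n)\in Form_s$ for $\sigma\in\Sigma_{s_1\ldots s_n,s}$, $\phi_i\in Form_{s_i}$. Abbreviations: $\wedge,\to,\leftrightarrow$; for $n\ge1$, $\sigma^\Box(\phi_1,\ldots,\phi_n):=\neg\sigma(\neg\phi_1,\ldots,\neg\phi_n)$. $\mathbf K=\{\mathbf K_s\}$: the least $S$-sorted set containing in each sort all classical propositional theorems and, for $n\ge1$, $\sigma\in\Sigma_{s_1\ldots s_n,s}$, $i\in[n]$, $\psi_j\in Form_{s_j}$, $\phi,\chi\in Form_{s_i}$, the axioms $\sigma^\Box(\ldots,\phi\to\chi,\ldots)\to(\sigma^\Box(\ldots,\phi,\ldots)\to\sigma^\Box(\ldots,\chi,\ldots))$ (position $i$, other arguments $\psi_j$) and $\sigma(\psi_1,\ldots,\psi_n)\leftrightarrow\neg\sigma^\Box(\neg\psi_1,\ldots,\neg\psi_n)$.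 $\mathbf K\Lambda_s$ is $\mathbf K_s$ plus all sort-preserving uniform substitution instances of formulas of $\Lambda_s$. Rules: modus ponens (MP) within a sort; universal generalization (UG): from $\phi\in Form_{s_i}$ infer $\sigma^\Box(\psi_1,\ldots,\psi_{i-1},\phi,\psi_{i+1},\ldots,\psi_n)$ for $\sigma\in\Sigma_{s_1\ldots s_n,s}$, $n\ge1$, $i\in[n]$. $\vdash^s_{\mathbf K\Lambda}\phi$ means $\phi\in Form_s$ has a finite proof from $\mathbf K\Lambda$ using MP and UG; for $\Phi_s\subseteq Form_s$, $\Phi_s\vdash^s_{\mathbf K\Lambda}\phi$ (local deduction) means there are $\phi_1,\ldots,\phi_n\in\Phi_s$ with $\vdash^s_{\mathbf K\Lambda}(\phi_1\wedge\cdots\wedge\phi_n)\to\phi$. Global deduction: for an $S$-sorted set $\Gamma=\{\Gamma_s\}$ and $\phi\in Form_s$, $\Gamma\vdash_{\mathbf K\Lambda}\phi$ means there is a sequence $\phi_1,\ldots,\phi_m=\phi$ of formulas (of arbitrary sorts $s_i$) each in $\mathbf K\Lambda_{s_i}$, or in $\Gamma_{s_i}$, or following from earlier ones by MP or UG. $\Gamma_G=\bigcup_k\Gamma^k$ where $\Gamma^0=\Gamma$ and $\Gamma^{k+1}_s=\Gamma^k_s\cup\{\sigma^\Box(\psi_1,\ldots,\psi_{i-1},\gamma,\psi_{i+1},\ldots,\psi_n)\mid \sigma\in\Sigma_{s_1\ldots s_n,s},n\ge1,i\in[n],\gamma\in\Gamma^k_{s_i},\psi_j\in Form_{s_j}\}$.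 -}

module Defs where

open import Data.List using (List; []; _∷_)
open import Data.List.Membership.Propositional using (_∈_)
open import Data.List.Relation.Unary.Any using (here; there)
open import Data.List.Relation.Unary.All using (All)
open import Data.Bool using (Bool; true; false; not; _∨_)
open import Data.Nat using (ℕ; zero; suc)
open import Data.Product using (Σ; _×_; _,_; ∃)
open import Data.Sum using (_⊎_)
open import Data.Empty using (⊥)
open import Relation.Binary.PropositionalEquality using (_≡_; refl)

-- Many-sorted modal logic over sorts S, signature Sig, propositional variables P.
-- Sig ss s : symbols σ of type s₁…sₙ → s where ss = s₁ ∷ … ∷ sₙ.
-- P s : propositional variables of sort s (pairwise disjointness is automatic
-- for a sort-indexed family).
module Logic (S : Set) (Sig : List S → S → Set) (P : S → Set) where

  infixr 5 _∷_
  mutual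
    data Form : S → Set where
      var  : ∀ {s} → P s → Form s
      ¬f   : ∀ {s} → Form s → Form s
      _∨f_ : ∀ {s} → Form s → Form s → Form s
      app  : ∀ {ss s} → Sig ss s → Args ss → Form s

    data Args : List S → Set where
      []  : Args []
      _∷_ : ∀ {s ss} → Form s → Args ss → Args (s ∷ ss)

  _⇒_ : ∀ {s} → Form s → Form s → Form s
  φ ⇒ χ = ¬f φ ∨f χ

  _∧f_ : ∀ {s} → Form s → Form s → Form s
  φ ∧f χ = ¬f (¬f φ ∨f ¬f χ)

  _⇔_ : ∀ {s} → Form s → Form s → Form s
  φ ⇔ χ = (φ ⇒ χ) ∧f (χ ⇒ φ)

  negArgs : ∀ {ss} → Args ss → Args ss
  negArgs []       = []
  negArgs (φ ∷ as) = ¬f φ ∷ negArgs as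

  box : ∀ {ss s} → Sig ss s → Args ss → Form s
  box σ as = ¬f (app σ (negArgs as))

  replace : ∀ {ss s'} → Args ss → s' ∈ ss → Form s' → Args ss
  replace (ψ ∷ as) (here refl) φ = φ ∷ as
  replace (ψ ∷ as) (there i)   φ = ψ ∷ replace as i φ

  -- classical propositional theorems: formulas true under every Boolean
  -- valuation of their propositional atoms (variables and σ-formulas)
  eval : ∀ {s} → (Form s → Bool) → Form s → Bool
  eval v (var p)   = v (var p)
  eval v (¬f φ)    = not (eval v φ)
  eval v (φ ∨f χ)  = eval v φ ∨ eval v χ
  eval v (app σ a) = v (app σ a)

  Tautology : ∀ {s} → Form s → Set
  Tautology φ = ∀ v → eval v φ ≡ true

  Subst : Set
  Subst = ∀ {s} → P s → Form s

  mutual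
    subst : ∀ {s} → Subst → Form s → Form s
    subst τ (var p)   = τ p
    subst τ (¬f φ)    = ¬f (subst τ φ)
    subst τ (φ ∨f χ)  = subst τ φ ∨f subst τ χ
    subst τ (app σ a) = app σ (substArgs τ a)

    substArgs : ∀ {ss} → Subst → Args ss → Args ss
    substArgs τ []       = []
    substArgs τ (φ ∷ as) = subst τ φ ∷ substArgs τ as

  FormSet : Set₁
  FormSet = (s : S) → Form s → Set

  data KAx : FormSet where
    taut : ∀ {s} {φ : Form s} → Tautology φ → KAx s φ
    kax  : ∀ {ss s s'} (σ : Sig ss s) (i : s' ∈ ss) (ψ : Args ss) (φ χ : Form s') →
           KAx s (box σ (replace ψ i (φ ⇒ χ)) ⇒
                   (box σ (replace ψ i φ) ⇒ box σ (replace ψ i χ)))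
    dual : ∀ {s₁ ss s} (σ : Sig (s₁ ∷ ss) s) (ψ : Args (s₁ ∷ ss)) →
           KAx s (app σ ψ ⇔ ¬f (box σ (negArgs ψ)))

  data KΛ (Λ : FormSet) : FormSet where
    kAx  : ∀ {s φ} → KAx s φ → KΛ Λ s φ
    inst : ∀ {s} (φ : Form s) (τ : Subst) → Λ s φ → KΛ Λ s (subst τ φ)

  data Deriv (Λ Γ : FormSet) : FormSet where
    ax  : ∀ {s φ} → KΛ Λ s φ → Deriv Λ Γ s φ
    hyp : ∀ {s φ} → Γ s φ → Deriv Λ Γ s φ
    mp  : ∀ {s} {φ χ : Form s} → Deriv Λ Γ s φ → Deriv Λ Γ s (φ ⇒ χ) → Deriv Λ Γ s χ
    ug  : ∀ {ss s s'} (σ : Sig ss s) (i : s' ∈ ss) (ψ : Args ss) {φ : Form s'} →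
          Deriv Λ Γ s' φ → Deriv Λ Γ s (box σ (replace ψ i φ))

  Empty : FormSet
  Empty _ _ = ⊥

  Thm : (Λ : FormSet) (s : S) → Form s → Set
  Thm Λ = Deriv Λ Empty

  GlobalDed : (Λ Γ : FormSet) (s : S) → Form s → Set
  GlobalDed = Deriv

  conjNE : ∀ {s} → Form s → List (Form s) → Form s
  conjNE φ []       = φ
  conjNE φ (χ ∷ l)  = φ ∧f conjNE χ l

  implies : ∀ {s} → List (Form s) → Form s → Form s
  implies []      φ = φ
  implies (χ ∷ l) φ = conjNE χ l ⇒ φ

  LocalDed : (Λ : FormSet) (s : S) → (Form s → Set) → Form s → Set
  LocalDed Λ s Φ φ = Σ (List (Form s)) λ l → All Φ l × Thm Λ s (implies l φ)

  GammaK : FormSet → ℕ → FormSet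
  GammaK Γ zero    = Γ
  GammaK Γ (suc k) s φ =
    GammaK Γ k s φ ⊎
    Σ (List S) λ ss → Σ S λ s' → Σ (Sig ss s) λ σ → Σ (s' ∈ ss) λ i →
    Σ (Form s') λ γ → Σ (Args ss) λ ψ →
      GammaK Γ k s' γ × (φ ≡ box σ (replace ψ i γ))

  GammaG : FormSet → FormSet
  GammaG Γ s φ = ∃ λ k → GammaK Γ k s φ

-- Right to left: every member of Γ_G is globally derivable by UG, so the
-- premises γ₁,…,γₙ of a local deduction are derivable and MP yields φ.
-- Left to right: by induction on the global derivation, collecting the finitely
-- many Γ_G-hypotheses used. MP concatenates the hypothesis lists; for UG the
-- local deduction is curried to ⊢ γ₁ → ⋯ → γₙ → φ, and UG followed by the
-- K axiom in each position turns it into ⊢ σ^□(…γ₁…) → ⋯ → σ^□(…γₙ…) → σ^□(…φ…),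
-- whose premises σ^□(…γₖ…) lie in Γ_G again.
module Submission where

open import Defs
open import Data.Bool using (Bool; true; false; not; _∨_; T)
open import Data.Bool.Properties using (T-≡)
open import Data.List using (List; []; _∷_; _++_; map)
open import Data.List.Membership.Propositional using (_∈_)
open import Data.List.Relation.Unary.All as All using (All; []; _∷_)
open import Data.List.Relation.Unary.All.Properties using (++⁺; ++⁻; map⁺)
open import Data.Nat using (zero; suc)
open import Data.Product using (_×_; _,_; proj₁; proj₂)
open import Data.Sum using (inj₁; inj₂)
open import Function using (const; id)
open import Function.Bundles using (_⇔_; mk⇔; Equivalence)
open import Relation.Binary.PropositionalEquality using (refl)

open Equivalence using (to; from)

module Deduction (S : Set) (Sig : List S → S → Set) (P : S → Set) where
  open Logic S Sig P hiding (_⇔_)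

  -- A record rather than T (eval v φ), so that Holds v φ determines φ in unification.
  record Holds {s} (v : Form s → Bool) (φ : Form s) : Set where
    constructor holds
    field T-eval : T (eval v φ)
  open Holds

  curried : ∀ {s} → List (Form s) → Form s → Form s
  curried []      φ = φ
  curried (γ ∷ l) φ = γ ⇒ curried l φ

  boxAt : ∀ {ss s s'} → Sig ss s → s' ∈ ss → Args ss → Form s' → Form s
  boxAt σ i ψ φ = box σ (replace ψ i φ)

  private
    variable
      s s' : S
      ss : List S
      Λ Γ : FormSet
      φ χ θ : Form s
      l : List (Form s)
      v : Form s → Bool

  T-not-∨ : ∀ {x y} → T (not x ∨ y) ⇔ (T x → T y)
  T-not-∨ {true}  = mk⇔ const (λ f → f _)
  T-not-∨ {false} = mk⇔ (λ _ ()) (const _)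

  T-not-∨-not : ∀ {x y} → T (not (not x ∨ not y)) ⇔ (T x × T y)
  T-not-∨-not {true}  {true}  = mk⇔ (const (_ , _)) (const _)
  T-not-∨-not {true}  {false} = mk⇔ (λ ()) proj₂
  T-not-∨-not {false}         = mk⇔ (λ ()) proj₁

  ⇒-holds : Holds v (φ ⇒ χ) ⇔ (Holds v φ → Holds v χ)
  ⇒-holds = mk⇔ (λ h hφ → holds (to T-not-∨ (T-eval h) (T-eval hφ)))
                (λ f → holds (from T-not-∨ λ t → T-eval (f (holds t))))

  ∧-holds : Holds v (φ ∧f χ) ⇔ (Holds v φ × Holds v χ)
  ∧-holds = mk⇔ (λ h → let t₁ , t₂ = to T-not-∨-not (T-eval h) in holds t₁ , holds t₂)
                (λ (h₁ , h₂) → holds (from T-not-∨-not (T-eval h₁ , T-eval h₂)))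

  conjNE-holds : ∀ l → Holds v (conjNE χ l) ⇔ All (Holds v) (χ ∷ l)
  conjNE-holds []      = mk⇔ (_∷ []) All.head
  conjNE-holds (θ ∷ l) = mk⇔
    (λ h → let h₁ , h₂ = to ∧-holds h in h₁ ∷ to (conjNE-holds l) h₂)
    (λ { (h₁ ∷ hs) → from ∧-holds (h₁ , from (conjNE-holds l) hs) })

  implies-holds : ∀ l → Holds v (implies l φ) ⇔ (All (Holds v) l → Holds v φ)
  implies-holds []      = mk⇔ const (λ f → f [])
  implies-holds (χ ∷ l) = mk⇔
    (λ h hs → to ⇒-holds h (from (conjNE-holds l) hs))
    (λ f → from ⇒-holds (λ h → f (to (conjNE-holds l) h)))

  curried-holds : ∀ l → Holds v (curried l φ) ⇔ (All (Holds v) l → Holds v φ)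
  curried-holds []      = mk⇔ const (λ f → f [])
  curried-holds (γ ∷ l) = mk⇔
    (λ { h (hγ ∷ hs) → to (curried-holds l) (to ⇒-holds h hγ) hs })
    (λ f → from ⇒-holds (λ hγ → from (curried-holds l) (λ hs → f (hγ ∷ hs))))

  tautology : Tautology φ → Deriv Λ Γ s φ
  tautology t = ax (kAx (taut t))

  entails⇒tautology : (∀ v → Holds v φ → Holds v χ) → Tautology (φ ⇒ χ)
  entails⇒tautology e v = to T-≡ (T-eval (from ⇒-holds (e v)))

  tautological-consequence : (∀ v → Holds v φ → Holds v χ) →
                             Deriv Λ Γ s φ → Deriv Λ Γ s χ
  tautological-consequence e d = mp d (tautology (entails⇒tautology e))

  tautological-consequence₂ : (∀ v → Holds v φ → Holds v χ → Holds v θ) →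
                              Deriv Λ Γ s φ → Deriv Λ Γ s χ → Deriv Λ Γ s θ
  tautological-consequence₂ e d₁ d₂ =
    mp d₂ (tautological-consequence (λ v h → from ⇒-holds (e v h)) d₁)

  ⇒-refl : ∀ φ → Deriv Λ Γ s (φ ⇒ φ)
  ⇒-refl φ = tautology (entails⇒tautology {φ = φ} λ _ → id)

  implies⇒curried : ∀ l → Deriv Λ Γ s (implies l φ) → Deriv Λ Γ s (curried l φ)
  implies⇒curried l =
    tautological-consequence λ _ h → from (curried-holds l) (to (implies-holds l) h)

  curried⇒implies : ∀ l → Deriv Λ Γ s (curried l φ) → Deriv Λ Γ s (implies l φ)
  curried⇒implies l =
    tautological-consequence λ _ h → from (implies-holds l) (to (curried-holds l) h)

  mp-curried : All (Deriv Λ Γ s) l → Deriv Λ Γ s (curried l φ) → Deriv Λ Γ s φ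
  mp-curried []       d = d
  mp-curried (e ∷ es) d = mp-curried es (mp e d)

  weaken : Thm Λ s φ → Deriv Λ Γ s φ
  weaken (ax a)       = ax a
  weaken (mp d e)     = mp (weaken d) (weaken e)
  weaken (ug σ i ψ d) = ug σ i ψ (weaken d)

  module _ (σ : Sig ss s) (i : s' ∈ ss) (ψ : Args ss) where

    boxAt-distrib-curried : ∀ l φ →
      Deriv Λ Γ s (boxAt σ i ψ (curried l φ) ⇒ curried (map (boxAt σ i ψ) l) (boxAt σ i ψ φ))
    boxAt-distrib-curried []      φ = ⇒-refl (boxAt σ i ψ φ)
    boxAt-distrib-curried (γ ∷ l) φ =
      tautological-consequence₂ (λ _ k ih → from ⇒-holds λ h → from ⇒-holds λ hγ →
                                   to ⇒-holds ih (to ⇒-holds (to ⇒-holds k h) hγ))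
        (ax (kAx (kax σ i ψ γ (curried l φ))))
        (boxAt-distrib-curried l φ)

    GammaG-boxAt : GammaG Γ s' φ → GammaG Γ s (boxAt σ i ψ φ)
    GammaG-boxAt (k , g) = suc k , inj₂ (_ , _ , σ , i , _ , ψ , g , refl)

  GammaG⇒Deriv : GammaG Γ s φ → Deriv Λ Γ s φ
  GammaG⇒Deriv (k , g) = GammaK⇒Deriv k g
    where
    GammaK⇒Deriv : ∀ {Λ s φ} k → GammaK Γ k s φ → Deriv Λ Γ s φ
    GammaK⇒Deriv zero    g        = hyp g
    GammaK⇒Deriv (suc k) (inj₁ g) = GammaK⇒Deriv k g
    GammaK⇒Deriv (suc k) (inj₂ (_ , _ , σ , i , _ , ψ , g , refl)) =
      ug σ i ψ (GammaK⇒Deriv k g)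

  local-axiom : ∀ {Φ : Form s → Set} → Thm Λ s φ → LocalDed Λ s Φ φ
  local-axiom d = [] , [] , d

  local-hyp : ∀ {Φ : Form s → Set} → Φ φ → LocalDed Λ s Φ φ
  local-hyp {φ = φ} h = φ ∷ [] , h ∷ [] , ⇒-refl φ

  local-mp : ∀ {Φ : Form s → Set} →
             LocalDed Λ s Φ φ → LocalDed Λ s Φ (φ ⇒ χ) → LocalDed Λ s Φ χ
  local-mp (l₁ , a₁ , d₁) (l₂ , a₂ , d₂) =
    l₁ ++ l₂ , ++⁺ a₁ a₂ , tautological-consequence₂ modusPonens d₁ d₂
    where
    modusPonens : ∀ v → Holds v (implies l₁ _) → Holds v (implies l₂ (_ ⇒ _)) →
                  Holds v (implies (l₁ ++ l₂) _)
    modusPonens v h₁ h₂ = from (implies-holds (l₁ ++ l₂)) λ hs →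
      let hs₁ , hs₂ = ++⁻ l₁ hs in
      to ⇒-holds (to (implies-holds l₂) h₂ hs₂) (to (implies-holds l₁) h₁ hs₁)

  local-ug : ∀ {Φ : Form s' → Set} {Ψ : Form s → Set}
             (σ : Sig ss s) (i : s' ∈ ss) (ψ : Args ss) →
             (∀ {γ} → Φ γ → Ψ (boxAt σ i ψ γ)) →
             LocalDed Λ s' Φ φ → LocalDed Λ s Ψ (boxAt σ i ψ φ)
  local-ug σ i ψ closed (l , a , d) =
    map (boxAt σ i ψ) l , map⁺ (All.map closed a) ,
    curried⇒implies (map (boxAt σ i ψ) l)
      (mp (ug σ i ψ (implies⇒curried l d)) (boxAt-distrib-curried σ i ψ l _))

  local⇒global : LocalDed Λ s (GammaG Γ s) φ → Deriv Λ Γ s φ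
  local⇒global (l , a , d) =
    mp-curried (All.map GammaG⇒Deriv a) (implies⇒curried l (weaken d))

  global⇒local : Deriv Λ Γ s φ → LocalDed Λ s (GammaG Γ s) φ
  global⇒local (ax a)       = local-axiom (ax a)
  global⇒local (hyp g)      = local-hyp (zero , g)
  global⇒local (mp d e)     = local-mp (global⇒local d) (global⇒local e)
  global⇒local (ug σ i ψ d) = local-ug σ i ψ (GammaG-boxAt σ i ψ) (global⇒local d)

mainTheorem7 : (S : Set) (Sig : List S → S → Set) (P : S → Set) →
    ((s : S) → P s) →
    (Λ Γ : Logic.FormSet S Sig P) (s : S) (φ : Logic.Form S Sig P s) →
    Logic.GlobalDed S Sig P Λ Γ s φ ⇔ Logic.LocalDed S Sig P Λ s (Logic.GammaG S Sig P Γ s) φ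
mainTheorem7 S Sig P _ Λ Γ s φ = mk⇔ global⇒local local⇒global
  where open Deduction S Sig P
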